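{- Let $n\ge 4$ and let $R$ be a $p_2$-orientation of $P_n$ containing adjacent edges $e_k=v_kv_{k+1}$ and $e_{k+1}=v_{k+1}v_{k+2}$ that are directed and agree. Let $R'$ be the orientation of the path $P'$ on the $n-2$ vertices $v_1,\dots,v_k,v_{k+3},\dots,v_n$ (in this order, with $v_k$ adjacent to $v_{k+3}$) obtained by contracting $e_k$ and $e_{k+1}$: the edges $e_i$ with $i\le k-1$ keep their orientation from $R$; the new edge $v_kv_{k+3}$ receives the orientation of $e_{k+2}$ reversed; and each edge $v_iv_{i+1}$ with $i\ge k+3$ receives the orientation of $e_i$ in $R$ reversed (a flat edge stays flat, a directed edge has its direction reversed). Then the number of $p_2$-configurations on $P_n$ with $|v_1|=0$ inducing $R$ equals the number of $p_2$-configurations on $P'$ with $|v_1|=0$ inducing $R'$.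
   Context: Parallel Diffusion on a finite simple graph $G$: a configuration assigns an integer stack size $|v|$ (possibly negative) to each vertex. In one step all vertices fire simultaneously: each vertex sends one chip to each neighbour with strictly smaller stack size. Starting from $C_0$, $C_{t+1}$ is obtained from $C_t$ by one step. A configuration $D$ is a $p_2$-configuration if there are $C_0$ and $N$ such that $C_{t+2}=C_t$ and $C_{t+1}\ne C_t$ for all $t\ge N$, and $D=C_t$ for some $t\ge N$. The path $P_n$ has vertices $v_1,\dots,v_n$ and edges $e_i=v_iv_{i+1}$, drawn horizontally with $v_1$ rightmost. A configuration induces the orientation in which each edge is directed from its endpoint with larger stack size to its endpoint with smaller stack size, and is flat if equal; a $p_2$-orientation is one induced by a $p_2$-configuration. A directed edge $e_i$ is a right edge if directed $v_{i+1}\to v_i$ and a left edge if directed $v_i\to v_{i+1}$; two directed edges agree if both are right or both are left. (In a $p_2$-orientation with $e_k,e_{k+1}$ agreeing, the edge $e_{k+2}$ exists.) -}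

module Defs where

open import Data.Nat using (ℕ; zero; suc; _+_; _∸_; _≤_; _<?_)
open import Data.Integer as ℤ using (ℤ; +_; _-_)
open import Relation.Nullary.Decidable using (⌊_⌋)
open import Data.Bool using (Bool; true; false; if_then_else_)
open import Data.Fin using (Fin; toℕ; fromℕ<)
open import Data.Vec using (Vec; lookup; tabulate)
open import Data.Maybe using (Maybe; just; nothing)
open import Data.List using (List; length)
open import Data.List.Membership.Propositional using (_∈_)
open import Data.List.Relation.Unary.All using (All)
open import Data.List.Relation.Unary.Unique.Propositional using (Unique)
open import Data.Product using (Σ; ∃; _×_; _,_)
open import Data.Sum using (_⊎_)
open import Function using (_∘_)
open import Relation.Nullary using (¬_; yes; no)
open import Relation.Binary.PropositionalEquality using (_≡_)

-- Paths and configurations.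
-- The path P_n has vertices v_1,…,v_n; vertex v_i is the index i-1 : Fin n.
-- A configuration on P_n is a vector of integer stack sizes.

Config : ℕ → Set
Config n = Vec ℤ n

atM : ∀ {n} → Config n → ℕ → Maybe ℤ
atM {n} C i with i <? n
... | yes p = just (lookup C (fromℕ< p))
... | no _  = nothing

chip : ℤ → ℤ → ℤ
chip a b = if ⌊ b ℤ.<? a ⌋ then + 1 else + 0

flow : ℤ → Maybe ℤ → ℤ
flow x (just u) = chip u x - chip x u
flow x nothing  = + 0

leftNb : ∀ {n} → Config n → ℕ → Maybe ℤ
leftNb C zero    = nothing
leftNb C (suc i) = atM C i

step : ∀ {n} → Config n → Config n
step C = tabulate λ j →
  let x = lookup C j in
  (x ℤ.+ flow x (leftNb C (toℕ j))) ℤ.+ flow x (atM C (suc (toℕ j)))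

iter : ∀ {n} → ℕ → Config n → Config n
iter zero    C = C
iter (suc t) C = step (iter t C)

IsP2 : ∀ {n} → Config n → Set
IsP2 {n} D = Σ (Config n) λ C₀ → Σ ℕ λ N →
  (∀ t → N ≤ t → (iter (suc (suc t)) C₀ ≡ iter t C₀) × ¬ (iter (suc t) C₀ ≡ iter t C₀))
  × (Σ ℕ λ t → N ≤ t × D ≡ iter t C₀)

-- Edge e_i = v_i v_{i+1} (1 ≤ i ≤ n-1) has 0-based index i-1.
-- right : directed v_{i+1} → v_i (|v_{i+1}| > |v_i|)
-- left  : directed v_i → v_{i+1} (|v_i| > |v_{i+1}|)
-- flat  : |v_i| = |v_{i+1}|

data Dir : Set where
  right left flat : Dir

Orientation : ℕ → Set
Orientation n = Vec Dir (n ∸ 1)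

cmpDir : Maybe ℤ → Maybe ℤ → Dir
cmpDir (just a) (just b) = if ⌊ a ℤ.<? b ⌋ then right else (if ⌊ b ℤ.<? a ⌋ then left else flat)
cmpDir _ _ = flat

induced : ∀ {n} → Config n → Orientation n
induced C = tabulate λ e → cmpDir (atM C (toℕ e)) (atM C (suc (toℕ e)))

IsP2Orientation : (n : ℕ) → Orientation n → Set
IsP2Orientation n R = Σ (Config n) λ D → IsP2 D × induced D ≡ R

dirAt : ∀ {m} → Vec Dir m → ℕ → Dir
dirAt {m} R i with i <? m
... | yes p = lookup R (fromℕ< p)
... | no _  = flat

Agree : Dir → Dir → Set
Agree d d' = (d ≡ right × d' ≡ right) ⊎ (d ≡ left × d' ≡ left)

rev : Dir → Dir
rev right = left
rev left  = right
rev flat  = flat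

-- R' on P' (vertices v_1,…,v_k,v_{k+3},…,v_n, i.e. n-2 vertices, n-3 edges),
-- obtained by contracting e_k, e_{k+1} (k is 1-based).  The P'-edge with
-- 0-based index j joins P'-positions j and j+1:
--   j < k-1 : it is e_{j+1}, orientation kept        (R at index j)
--   j = k-1 : it is v_k v_{k+3}, e_{k+2} reversed    (R at index k+1)
--   j ≥ k   : it is v_{j+3}v_{j+4}, e_{j+3} reversed (R at index j+2)
contractDir : ∀ {m} → Vec Dir m → ℕ → ℕ → Dir
contractDir R k j with suc j <? k
... | yes _ = dirAt R j
... | no _ with j <? k
...   | yes _ = rev (dirAt R (suc k))
...   | no _  = rev (dirAt R (j + 2))

contract : (n : ℕ) → Orientation n → ℕ → Orientation (n ∸ 2)
contract n R k = tabulate λ j → contractDir R k (toℕ j)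

P2Rooted : (n : ℕ) → Orientation n → Config n → Set
P2Rooted n R D = IsP2 D × atM D 0 ≡ just (+ 0) × induced D ≡ R

HasCount : ∀ {A : Set} → (A → Set) → ℕ → Set
HasCount {A} P m = Σ (List A) λ xs →
  length xs ≡ m × Unique xs × All P xs × (∀ x → P x → x ∈ xs)

-- In a period-two orbit of Parallel Diffusion every edge reverses at each step. Two consecutive
-- agreeing edges e_k, e_{k+1} then force a rigid local shape: |v_{k+1}| = |v_k| ± 1 and
-- |v_{k+2}| = |v_k| ± 2 (the sign given by the common direction), the flanking edges e_{k-1}, e_{k+2}
-- exist and point the other way, and after one step v_k and v_{k+2} have exchanged heights. So gluing
-- v_1,…,v_k of a configuration to v_{k+3},…,v_n of its successor, whose edges there are reversed as R'
-- prescribes, gives a p₂-configuration on P' with the same |v_1|; re-inserting the unit ramp undoes this.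

module Submission where

open import Defs
open import Data.Nat using (ℕ; zero; suc; _+_; _∸_; _≤_; _<_; _<?_; _≤?_; z≤n; s≤s)
import Data.Nat.Properties as ℕP
open import Data.Integer as ℤ using (ℤ; +_; -[1+_])
import Data.Integer.Properties as ℤP
open import Data.Integer.Tactic.RingSolver using (solve-∀)
open import Data.Maybe using (Maybe; just; nothing)
open import Data.Fin using (Fin; toℕ; fromℕ<)
open import Data.Fin.Properties using (toℕ-fromℕ<; fromℕ<-toℕ; toℕ<n)
open import Data.Vec using (Vec; lookup; tabulate)
open import Data.Vec.Properties using (lookup∘tabulate; tabulate∘lookup; tabulate-cong)
open import Data.List using (map)
open import Data.List.Properties using (length-map; map-∘; map-id-local)
open import Data.List.Membership.Propositional using (_∈_)
open import Data.List.Membership.Propositional.Properties using (∈-map⁺)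
import Data.List.Relation.Unary.All as All
import Data.List.Relation.Unary.All.Properties as All
open import Data.List.Relation.Unary.Unique.Propositional using (Unique)
import Data.List.Relation.Unary.Unique.Propositional.Properties as Unique
open import Function using (_∘_)
open import Data.Product using (∃; _×_; _,_; proj₁; proj₂)
open import Data.Sum using (_⊎_; inj₁; inj₂)
open import Relation.Nullary using (¬_; Dec; yes; no; contradiction)
open import Relation.Binary using (tri<; tri≈; tri>)
open import Relation.Binary.PropositionalEquality

⟦_⟧ : Dir → ℤ
⟦ right ⟧ = + 1
⟦ left ⟧ = -[1+ 0 ]
⟦ flat ⟧ = + 0

data Directed : Dir → Set where
  right : Directed right
  left  : Directed left

rev-directed : ∀ {d} → Directed d → Directed (rev d)
rev-directed right = left
rev-directed left = right

flat-undirected : ∀ {d} → Directed d → ¬ flat ≡ d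
flat-undirected right ()
flat-undirected left ()

rev-involutive : ∀ d → rev (rev d) ≡ d
rev-involutive right = refl
rev-involutive left = refl
rev-involutive flat = refl

⟦rev⟧ : ∀ d → ⟦ rev d ⟧ ≡ ℤ.- ⟦ d ⟧
⟦rev⟧ right = refl
⟦rev⟧ left = refl
⟦rev⟧ flat = refl

⟦⟧-injective : ∀ {d e} → ⟦ d ⟧ ≡ ⟦ e ⟧ → d ≡ e
⟦⟧-injective {right} {right} _ = refl
⟦⟧-injective {left} {left} _ = refl
⟦⟧-injective {flat} {flat} _ = refl
⟦⟧-injective {right} {left} ()
⟦⟧-injective {right} {flat} ()
⟦⟧-injective {left} {right} ()
⟦⟧-injective {left} {flat} ()
⟦⟧-injective {flat} {right} ()
⟦⟧-injective {flat} {left} ()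

-- slope x y orients an edge from a vertex of height x to one of height y, and ⟦ slope x y ⟧ is the
-- net number of chips the first vertex receives across it in one step (flow-cmpDir).
slope : ℤ → ℤ → Dir
slope x y = cmpDir (just x) (just y)

slope-< : ∀ {x y} → x ℤ.< y → slope x y ≡ right
slope-< {x} {y} x<y with x ℤ.<? y
... | yes _ = refl
... | no x≮y = contradiction x<y x≮y

slope-> : ∀ {x y} → y ℤ.< x → slope x y ≡ left
slope-> {x} {y} y<x with x ℤ.<? y | y ℤ.<? x
... | yes x<y | _ = contradiction y<x (ℤP.<-asym x<y)
... | no _ | yes _ = refl
... | no _ | no y≮x = contradiction y<x y≮x

slope-refl : ∀ x → slope x x ≡ flat
slope-refl x with x ℤ.<? x
... | yes x<x = contradiction x<x (ℤP.<-irrefl refl)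
... | no _ = refl

slope-swap : ∀ x y → slope y x ≡ rev (slope x y)
slope-swap x y with x ℤ.<? y | y ℤ.<? x
... | yes x<y | yes y<x = contradiction y<x (ℤP.<-asym x<y)
... | yes _ | no _ = refl
... | no _ | yes _ = refl
... | no _ | no _ = refl

flow-cmpDir : ∀ x mu → flow x mu ≡ ⟦ cmpDir (just x) mu ⟧
flow-cmpDir x nothing = refl
flow-cmpDir x (just u) with x ℤ.<? u | u ℤ.<? x
... | yes x<u | yes u<x = contradiction u<x (ℤP.<-asym x<u)
... | yes _ | no _ = refl
... | no _ | yes _ = refl
... | no _ | no _ = refl

slope-translate : ∀ c x y → slope (x ℤ.+ c) (y ℤ.+ c) ≡ slope x y
slope-translate c x y with ℤP.<-cmp x y
... | tri< x<y _ _ = trans (slope-< (ℤP.+-monoˡ-< c x<y)) (sym (slope-< x<y))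
... | tri≈ _ refl _ = trans (slope-refl (x ℤ.+ c)) (sym (slope-refl x))
... | tri> _ _ y<x = trans (slope-> (ℤP.+-monoˡ-< c y<x)) (sym (slope-> y<x))

slope-relative : ∀ c x y → slope (x ℤ.+ c) y ≡ slope c (y ℤ.- x)
slope-relative c x y = begin
  slope (x ℤ.+ c) y                       ≡⟨ cong₂ slope (ℤP.+-comm x c) (y≡y-x+x x y) ⟩
  slope (c ℤ.+ x) ((y ℤ.- x) ℤ.+ x)       ≡⟨ slope-translate x c (y ℤ.- x) ⟩
  slope c (y ℤ.- x)                       ∎
  where
  open ≡-Reasoning
  y≡y-x+x : ∀ x y → y ≡ (y ℤ.- x) ℤ.+ x
  y≡y-x+x = solve-∀

slope-step : ∀ {d} → Directed d → ∀ x → slope x (x ℤ.+ ⟦ d ⟧) ≡ d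
slope-step {d} dd x = begin
  slope x (x ℤ.+ ⟦ d ⟧)              ≡⟨ cong₂ slope (sym (ℤP.+-identityˡ x)) (ℤP.+-comm x ⟦ d ⟧) ⟩
  slope (+ 0 ℤ.+ x) (⟦ d ⟧ ℤ.+ x)    ≡⟨ slope-translate x (+ 0) ⟦ d ⟧ ⟩
  slope (+ 0) ⟦ d ⟧                  ≡⟨ from-zero dd ⟩
  d                                  ∎
  where
  open ≡-Reasoning
  from-zero : ∀ {d} → Directed d → slope (+ 0) ⟦ d ⟧ ≡ d
  from-zero right = refl
  from-zero left = refl

slope-step-back : ∀ {d} → Directed d → ∀ x → slope (x ℤ.+ ⟦ d ⟧) x ≡ rev d
slope-step-back dd x = trans (slope-swap x _) (cong rev (slope-step dd x))

pull-cancel : ∀ d x → (x ℤ.+ ⟦ rev d ⟧) ℤ.+ ⟦ d ⟧ ≡ x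
pull-cancel d x = trans (cong (λ r → (x ℤ.+ r) ℤ.+ ⟦ d ⟧) (⟦rev⟧ d)) (cancel x ⟦ d ⟧)
  where
  cancel : ∀ x u → (x ℤ.+ ℤ.- u) ℤ.+ u ≡ x
  cancel = solve-∀

step-back : ∀ d x → (x ℤ.+ ⟦ d ⟧) ℤ.+ ⟦ rev d ⟧ ≡ x
step-back d x = trans (cong (ℤ._+_ (x ℤ.+ ⟦ d ⟧)) (⟦rev⟧ d)) (cancel x ⟦ d ⟧)
  where
  cancel : ∀ x u → (x ℤ.+ u) ℤ.+ ℤ.- u ≡ x
  cancel = solve-∀

no-double-step : ∀ {d} → Directed d → ∀ x → ¬ (x ℤ.+ ⟦ d ⟧) ℤ.+ ⟦ d ⟧ ≡ x
no-double-step {d} dd x x+2d≡x =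
  nonzero dd (trans (sym (isolate x ⟦ d ⟧)) (trans (cong (ℤ._- x) x+2d≡x) (ℤP.+-inverseʳ x)))
  where
  isolate : ∀ x u → ((x ℤ.+ u) ℤ.+ u) ℤ.- x ≡ u ℤ.+ u
  isolate = solve-∀
  nonzero : ∀ {d} → Directed d → ¬ ⟦ d ⟧ ℤ.+ ⟦ d ⟧ ≡ + 0
  nonzero right ()
  nonzero left ()

ramp-middle : ∀ {d} → Directed d → ∀ x →
  (x ℤ.+ ⟦ d ⟧ ℤ.+ ⟦ slope (x ℤ.+ ⟦ d ⟧) x ⟧) ℤ.+ ⟦ slope (x ℤ.+ ⟦ d ⟧) ((x ℤ.+ ⟦ d ⟧) ℤ.+ ⟦ d ⟧) ⟧
    ≡ ((x ℤ.+ ⟦ d ⟧) ℤ.+ ⟦ d ⟧) ℤ.+ ⟦ rev d ⟧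
ramp-middle {d} dd x = begin
  (x ℤ.+ ⟦ d ⟧ ℤ.+ ⟦ slope (x ℤ.+ ⟦ d ⟧) x ⟧) ℤ.+ ⟦ slope (x ℤ.+ ⟦ d ⟧) ((x ℤ.+ ⟦ d ⟧) ℤ.+ ⟦ d ⟧) ⟧
    ≡⟨ cong₂ (λ l r → (x ℤ.+ ⟦ d ⟧ ℤ.+ ⟦ l ⟧) ℤ.+ ⟦ r ⟧)
             (slope-step-back dd x) (slope-step dd (x ℤ.+ ⟦ d ⟧)) ⟩
  (x ℤ.+ ⟦ d ⟧ ℤ.+ ⟦ rev d ⟧) ℤ.+ ⟦ d ⟧     ≡⟨ pull-cancel d (x ℤ.+ ⟦ d ⟧) ⟩
  x ℤ.+ ⟦ d ⟧                               ≡⟨ step-back d (x ℤ.+ ⟦ d ⟧) ⟨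
  ((x ℤ.+ ⟦ d ⟧) ℤ.+ ⟦ d ⟧) ℤ.+ ⟦ rev d ⟧   ∎
  where open ≡-Reasoning

-- Heights are integers: a strict inequality that a move of at most two units reverses forces a unit gap.
gap-rigidity : ∀ {d} → Directed d → ∀ e δ →
  slope (+ 0) δ ≡ d → slope (⟦ e ⟧ ℤ.+ ⟦ d ⟧) δ ≡ rev d → e ≡ d × δ ≡ ⟦ d ⟧
gap-rigidity right right (+ 1) refl refl = refl , refl
gap-rigidity right flat (+ 1) _ ()
gap-rigidity right left (+ 1) _ ()
gap-rigidity right right (+ 2) _ ()
gap-rigidity right right (+ suc (suc (suc k))) _ ()
gap-rigidity right flat (+ suc (suc k)) _ ()
gap-rigidity right left (+ suc (suc k)) _ ()
gap-rigidity right e (+ 0) () _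
gap-rigidity right e -[1+ k ] () _
gap-rigidity left left -[1+ 0 ] refl refl = refl , refl
gap-rigidity left left -[1+ 1 ] _ ()
gap-rigidity left left -[1+ suc (suc k) ] _ ()
gap-rigidity left flat -[1+ 0 ] _ ()
gap-rigidity left flat -[1+ suc k ] _ ()
gap-rigidity left right -[1+ k ] _ ()
gap-rigidity left e (+ 0) () _
gap-rigidity left e (+ suc k) () _

rigidity : ∀ {d} → Directed d → ∀ e {x y} → slope x y ≡ d →
  slope ((x ℤ.+ ⟦ e ⟧) ℤ.+ ⟦ d ⟧) y ≡ rev d → e ≡ d × y ≡ x ℤ.+ ⟦ d ⟧
rigidity {d} dd e {x} {y} up down =
  proj₁ gap , trans (y≡x+[y-x] x y) (cong (ℤ._+_ x) (proj₂ gap))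
  where
  y≡x+[y-x] : ∀ x y → y ≡ x ℤ.+ (y ℤ.- x)
  y≡x+[y-x] = solve-∀
  up′ : slope (+ 0) (y ℤ.- x) ≡ d
  up′ = trans (sym (slope-relative (+ 0) x y)) (trans (cong (λ u → slope u y) (ℤP.+-identityʳ x)) up)
  down′ : slope (⟦ e ⟧ ℤ.+ ⟦ d ⟧) (y ℤ.- x) ≡ rev d
  down′ = trans (sym (slope-relative _ x y)) (trans (cong (λ u → slope u y) (sym (ℤP.+-assoc x ⟦ e ⟧ ⟦ d ⟧))) down)
  gap : e ≡ d × y ℤ.- x ≡ ⟦ d ⟧
  gap = gap-rigidity dd e (y ℤ.- x) up′ down′

rigidity-right : ∀ {d} → Directed d → ∀ e {x y} → slope x y ≡ d →
  slope x ((y ℤ.+ ⟦ rev d ⟧) ℤ.+ ⟦ e ⟧) ≡ rev d → e ≡ rev d × y ≡ x ℤ.+ ⟦ d ⟧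
rigidity-right {d} dd e {x} {y} up down = proj₁ mirrored , y≡x+d
  where
  swap-terms : ∀ y u v → (y ℤ.+ u) ℤ.+ v ≡ (y ℤ.+ v) ℤ.+ u
  swap-terms = solve-∀
  down′ : slope ((y ℤ.+ ⟦ e ⟧) ℤ.+ ⟦ rev d ⟧) x ≡ rev (rev d)
  down′ = trans (cong (λ u → slope u x) (swap-terms y ⟦ e ⟧ ⟦ rev d ⟧))
                (trans (slope-swap x _) (cong rev down))
  mirrored : e ≡ rev d × x ≡ y ℤ.+ ⟦ rev d ⟧
  mirrored = rigidity (rev-directed dd) e {y} {x} (trans (slope-swap x y) (cong rev up)) down′
  cancel : ∀ y u → y ≡ (y ℤ.+ ℤ.- u) ℤ.+ u
  cancel = solve-∀
  y≡x+d : y ≡ x ℤ.+ ⟦ d ⟧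
  y≡x+d = trans (cancel y ⟦ d ⟧) (cong (ℤ._+ ⟦ d ⟧) (sym (trans (proj₂ mirrored) (cong (ℤ._+_ y) (⟦rev⟧ d)))))

-- A configuration of P_m is handled as a function ℕ → ℤ of which only the positions 0,…,m-1 matter;
-- position i is the vertex v_{i+1}.
opaque
  at : ℕ → (ℕ → ℤ) → ℕ → Maybe ℤ
  at m f i with i <? m
  ... | yes _ = just (f i)
  ... | no _ = nothing

  at-in : ∀ {m f i} → i < m → at m f i ≡ just (f i)
  at-in {m} {i = i} i<m with i <? m
  ... | yes _ = refl
  ... | no i≮m = contradiction i<m i≮m

  at-out : ∀ {m f i} → ¬ i < m → at m f i ≡ nothing
  at-out {m} {i = i} i≮m with i <? m
  ... | yes i<m = contradiction i<m i≮m
  ... | no _ = refl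

leftOf : ℕ → (ℕ → ℤ) → ℕ → Maybe ℤ
leftOf m f zero = nothing
leftOf m f (suc i) = at m f i

diffuse : ℕ → (ℕ → ℤ) → ℕ → ℤ
diffuse m f i =
  (f i ℤ.+ ⟦ cmpDir (just (f i)) (leftOf m f i) ⟧) ℤ.+ ⟦ cmpDir (just (f i)) (at m f (suc i)) ⟧

infix 4 _≈⟨_⟩_
_≈⟨_⟩_ : (ℕ → ℤ) → ℕ → (ℕ → ℤ) → Set
f ≈⟨ m ⟩ g = ∀ i → i < m → f i ≡ g i

≈-sym : ∀ {m f g} → f ≈⟨ m ⟩ g → g ≈⟨ m ⟩ f
≈-sym f≈g i i<m = sym (f≈g i i<m)

≈-trans : ∀ {m f g h} → f ≈⟨ m ⟩ g → g ≈⟨ m ⟩ h → f ≈⟨ m ⟩ h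
≈-trans f≈g g≈h i i<m = trans (f≈g i i<m) (g≈h i i<m)

at-cong : ∀ {m f g} → f ≈⟨ m ⟩ g → ∀ i → at m f i ≡ at m g i
at-cong {m} {f} {g} f≈g i with i <? m
... | yes i<m = trans (at-in i<m) (trans (cong just (f≈g i i<m)) (sym (at-in i<m)))
... | no i≮m = trans (at-out i≮m) (sym (at-out i≮m))

leftOf-cong : ∀ {m f g} → f ≈⟨ m ⟩ g → ∀ i → leftOf m f i ≡ leftOf m g i
leftOf-cong f≈g zero = refl
leftOf-cong f≈g (suc i) = at-cong f≈g i

diffuse-local : ∀ {m m' f g i j} → f i ≡ g j →
  cmpDir (just (f i)) (leftOf m f i) ≡ cmpDir (just (g j)) (leftOf m' g j) →
  cmpDir (just (f i)) (at m f (suc i)) ≡ cmpDir (just (g j)) (at m' g (suc j)) →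
  diffuse m f i ≡ diffuse m' g j
diffuse-local fi≡gj l≡l r≡r = cong₂ ℤ._+_ (cong₂ ℤ._+_ fi≡gj (cong ⟦_⟧ l≡l)) (cong ⟦_⟧ r≡r)

diffuse-window : ∀ {m m' f g i j} → f i ≡ g j → leftOf m f i ≡ leftOf m' g j →
  at m f (suc i) ≡ at m' g (suc j) → diffuse m f i ≡ diffuse m' g j
diffuse-window {m} {m'} {f} {g} {i} {j} fi≡gj l≡l r≡r =
  diffuse-local {m} {m'} {f} {g} {i} {j} fi≡gj
    (cong₂ (λ x → cmpDir (just x)) fi≡gj l≡l) (cong₂ (λ x → cmpDir (just x)) fi≡gj r≡r)

diffuse-cong : ∀ {m f g} → f ≈⟨ m ⟩ g → diffuse m f ≈⟨ m ⟩ diffuse m g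
diffuse-cong {m} {f} {g} f≈g i i<m = diffuse-window {m} {m} {f} {g} (f≈g i i<m) (leftOf-cong f≈g i) (at-cong f≈g (suc i))

diffuse-inner : ∀ {m f i} → suc i < m →
  diffuse m f i ≡ (f i ℤ.+ ⟦ cmpDir (just (f i)) (leftOf m f i) ⟧) ℤ.+ ⟦ slope (f i) (f (suc i)) ⟧
diffuse-inner {m} {f} {i} si<m =
  cong (λ r → (f i ℤ.+ ⟦ cmpDir (just (f i)) (leftOf m f i) ⟧) ℤ.+ ⟦ cmpDir (just (f i)) r ⟧) (at-in {m} {f} si<m)

diffuse-pulled : ∀ {m f i d} → suc i < m → cmpDir (just (f i)) (leftOf m f i) ≡ d → slope (f i) (f (suc i)) ≡ d →
  diffuse m f i ≡ (f i ℤ.+ ⟦ d ⟧) ℤ.+ ⟦ d ⟧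
diffuse-pulled {m} {f} {i} si<m ←i i→ =
  trans (diffuse-inner {m} {f} si<m) (cong₂ (λ l r → (f i ℤ.+ ⟦ l ⟧) ℤ.+ ⟦ r ⟧) ←i i→)

diffuse-interior : ∀ {m f j} → suc (suc j) < m →
  diffuse m f (suc j) ≡ (f (suc j) ℤ.+ ⟦ slope (f (suc j)) (f j) ⟧) ℤ.+ ⟦ slope (f (suc j)) (f (suc (suc j))) ⟧
diffuse-interior {m} {f} {j} ssj<m =
  trans (diffuse-inner {m} {f} ssj<m)
        (cong (λ l → (f (suc j) ℤ.+ ⟦ cmpDir (just (f (suc j))) l ⟧) ℤ.+ ⟦ slope (f (suc j)) (f (suc (suc j))) ⟧)
              (at-in {m} {f} (ℕP.<-trans (ℕP.n<1+n j) (ℕP.<-trans (ℕP.n<1+n (suc j)) ssj<m))))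

diffuse-interior-≡ : ∀ {m f j u v w} → suc (suc j) < m → f (suc j) ≡ u → f j ≡ v → f (2 + j) ≡ w →
  diffuse m f (suc j) ≡ (u ℤ.+ ⟦ slope u v ⟧) ℤ.+ ⟦ slope u w ⟧
diffuse-interior-≡ {m} {f} ssj<m refl refl refl = diffuse-interior {m} {f} ssj<m

module _ {a m m' : ℕ} {f g : ℕ → ℤ} (agree : ∀ j → j ≤ a → f j ≡ g j) (a<m : a < m) (a<m' : a < m') where

  at-prefix : ∀ {j} → j ≤ a → at m f j ≡ at m' g j
  at-prefix j≤a =
    trans (at-in (ℕP.≤-<-trans j≤a a<m)) (trans (cong just (agree _ j≤a)) (sym (at-in (ℕP.≤-<-trans j≤a a<m'))))

  leftOf-prefix : ∀ i → i ≤ a → leftOf m f i ≡ leftOf m' g i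
  leftOf-prefix zero _ = refl
  leftOf-prefix (suc j) sj≤a = at-prefix (ℕP.<⇒≤ sj≤a)

  diffuse-prefix : cmpDir (just (f a)) (at m f (suc a)) ≡ cmpDir (just (g a)) (at m' g (suc a)) →
    ∀ i → i ≤ a → diffuse m f i ≡ diffuse m' g i
  diffuse-prefix a→ i i≤a with ℕP.m≤n⇒m<n∨m≡n i≤a
  ... | inj₁ i<a = diffuse-window {m} {m'} {f} {g} (agree i i≤a) (leftOf-prefix i i≤a) (at-prefix i<a)
  ... | inj₂ refl = diffuse-local {m} {m'} {f} {g}
    (agree a ℕP.≤-refl) (cong₂ (λ x → cmpDir (just x)) (agree a ℕP.≤-refl) (leftOf-prefix a ℕP.≤-refl)) a→

at-shift : ∀ {m f g j} → g (2 + j) ≡ f j → at (2 + m) g (2 + j) ≡ at m f j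
at-shift {m} {j = j} g≡f with j <? m
... | yes j<m = trans (at-in (s≤s (s≤s j<m))) (trans (cong just g≡f) (sym (at-in j<m)))
... | no j≮m = trans (at-out (λ ssj<ssm → j≮m (ℕP.≤-pred (ℕP.≤-pred ssj<ssm)))) (sym (at-out j≮m))

diffuse-shift : ∀ {a m f g} → (∀ j → a ≤ j → g (2 + j) ≡ f j) →
  ∀ j → a ≤ j → diffuse (2 + m) g (2 + suc j) ≡ diffuse m f (suc j)
diffuse-shift {a} {m} {f} {g} agree j a≤j =
  diffuse-window {2 + m} {m} {g} {f} (agree (suc j) (ℕP.m≤n⇒m≤1+n a≤j)) (at-shift {m} {f} {g} (agree j a≤j))
                 (at-shift {m} {f} {g} (agree (suc (suc j)) (ℕP.m≤n⇒m≤1+n (ℕP.m≤n⇒m≤1+n a≤j))))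

opaque
  get : ∀ {m} → Config m → ℕ → ℤ
  get {m} C i with i <? m
  ... | yes i<m = lookup C (fromℕ< i<m)
  ... | no _ = + 0

  get-in : ∀ {m} (C : Config m) {i} (i<m : i < m) → get C i ≡ lookup C (fromℕ< i<m)
  get-in {m} C {i} i<m with i <? m
  ... | yes _ = refl
  ... | no i≮m = contradiction i<m i≮m

get-toℕ : ∀ {m} (C : Config m) (j : Fin m) → get C (toℕ j) ≡ lookup C j
get-toℕ C j = trans (get-in C (toℕ<n j)) (cong (lookup C) (fromℕ<-toℕ j (toℕ<n j)))

get-injective : ∀ {m} {C C' : Config m} → get C ≈⟨ m ⟩ get C' → C ≡ C'
get-injective {C = C} {C'} C≈C' = begin
  C                       ≡⟨ tabulate∘lookup C ⟨
  tabulate (lookup C)     ≡⟨ tabulate-cong (λ j → trans (sym (get-toℕ C j))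
                                                 (trans (C≈C' (toℕ j) (toℕ<n j)) (get-toℕ C' j))) ⟩
  tabulate (lookup C')    ≡⟨ tabulate∘lookup C' ⟩
  C'                      ∎
  where open ≡-Reasoning

get-tabulate : ∀ {m} (h : ℕ → ℤ) → get {m} (tabulate (h ∘ toℕ)) ≈⟨ m ⟩ h
get-tabulate h i i<m = begin
  get (tabulate (h ∘ toℕ)) i                ≡⟨ get-in (tabulate (h ∘ toℕ)) i<m ⟩
  lookup (tabulate (h ∘ toℕ)) (fromℕ< i<m)  ≡⟨ lookup∘tabulate (h ∘ toℕ) (fromℕ< i<m) ⟩
  h (toℕ (fromℕ< i<m))                      ≡⟨ cong h (toℕ-fromℕ< i<m) ⟩
  h i                                       ∎
  where open ≡-Reasoning

atM-get : ∀ {m} (C : Config m) i → atM C i ≡ at m (get C) i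
atM-get {m} C i with i <? m
... | yes i<m = trans (cong just (sym (get-in C i<m))) (sym (at-in i<m))
... | no i≮m = sym (at-out i≮m)

leftNb-get : ∀ {m} (C : Config m) i → leftNb C i ≡ leftOf m (get C) i
leftNb-get C zero = refl
leftNb-get C (suc i) = atM-get C i

get-step : ∀ {m} (C : Config m) → get (step C) ≈⟨ m ⟩ diffuse m (get C)
get-step {m} C i i<m = begin
  get (step C) i                   ≡⟨ get-in (step C) i<m ⟩
  lookup (step C) (fromℕ< i<m)     ≡⟨ lookup∘tabulate _ (fromℕ< i<m) ⟩
  (x ℤ.+ flow x (leftNb C i′)) ℤ.+ flow x (atM C (suc i′))
    ≡⟨ cong (λ j → (x ℤ.+ flow x (leftNb C j)) ℤ.+ flow x (atM C (suc j))) (toℕ-fromℕ< i<m) ⟩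
  (x ℤ.+ flow x (leftNb C i)) ℤ.+ flow x (atM C (suc i))
    ≡⟨ cong₂ (λ l r → (x ℤ.+ flow x l) ℤ.+ flow x r) (leftNb-get C i) (atM-get C (suc i)) ⟩
  (x ℤ.+ flow x (leftOf m X i)) ℤ.+ flow x (at m X (suc i))
    ≡⟨ cong (λ y → (y ℤ.+ flow y (leftOf m X i)) ℤ.+ flow y (at m X (suc i))) (sym (get-in C i<m)) ⟩
  (X i ℤ.+ flow (X i) (leftOf m X i)) ℤ.+ flow (X i) (at m X (suc i))
    ≡⟨ cong₂ (λ l r → (X i ℤ.+ l) ℤ.+ r) (flow-cmpDir (X i) (leftOf m X i)) (flow-cmpDir (X i) (at m X (suc i))) ⟩
  diffuse m X i                    ∎
  where
  open ≡-Reasoning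
  X = get C
  i′ = toℕ (fromℕ< i<m)
  x = lookup C (fromℕ< i<m)

iter-period2 : ∀ {m} {D : Config m} → step (step D) ≡ D → ∀ t → iter (2 + t) D ≡ iter t D
iter-period2 period2 zero = period2
iter-period2 period2 (suc t) = cong step (iter-period2 period2 t)

iter-alternates : ∀ {m} {D : Config m} → step (step D) ≡ D → ∀ t → iter t D ≡ D ⊎ iter t D ≡ step D
iter-alternates period2 zero = inj₁ refl
iter-alternates period2 (suc t) with iter-alternates period2 t
... | inj₁ even = inj₂ (cong step even)
... | inj₂ odd = inj₁ (trans (cong step odd) period2)

isP2-intro : ∀ {m} {D : Config m} → step (step D) ≡ D → ¬ step D ≡ D → IsP2 D
isP2-intro {D = D} period2 moving = D , 0 , (λ t _ → iter-period2 period2 t , stays-moving t) , 0 , z≤n , refl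
  where
  stays-moving : ∀ t → ¬ iter (suc t) D ≡ iter t D
  stays-moving t fixed with iter-alternates period2 t
  ... | inj₁ even = moving (trans (cong step (sym even)) (trans fixed even))
  ... | inj₂ odd = moving (sym (trans (sym period2) (trans (cong step (sym odd)) (trans fixed odd))))

isP2-elim : ∀ {m} {D : Config m} → IsP2 D → step (step D) ≡ D × ¬ step D ≡ D
isP2-elim (C₀ , N , eventually , t , N≤t , refl) = eventually t N≤t

dirAt-in : ∀ {k} (R : Vec Dir k) {i} (i<k : i < k) → dirAt R i ≡ lookup R (fromℕ< i<k)
dirAt-in {k} R {i} i<k with i <? k
... | yes _ = refl
... | no i≮k = contradiction i<k i≮k

dirAt-ext : ∀ {k} {R R' : Vec Dir k} → (∀ i → i < k → dirAt R i ≡ dirAt R' i) → R ≡ R'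
dirAt-ext {R = R} {R'} R≗R' = begin
  R                       ≡⟨ tabulate∘lookup R ⟨
  tabulate (lookup R)     ≡⟨ tabulate-cong (λ j → trans (lookup-dirAt R j)
                                                 (trans (R≗R' (toℕ j) (toℕ<n j)) (sym (lookup-dirAt R' j)))) ⟩
  tabulate (lookup R')    ≡⟨ tabulate∘lookup R' ⟩
  R'                      ∎
  where
  open ≡-Reasoning
  lookup-dirAt : ∀ {k} (R : Vec Dir k) j → lookup R j ≡ dirAt R (toℕ j)
  lookup-dirAt R j = trans (cong (lookup R) (sym (fromℕ<-toℕ j (toℕ<n j)))) (sym (dirAt-in R (toℕ<n j)))

dirAt-tabulate : ∀ {k} (h : ℕ → Dir) {i} → i < k → dirAt (tabulate {n = k} (h ∘ toℕ)) i ≡ h i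
dirAt-tabulate h i<k = trans (dirAt-in _ i<k) (trans (lookup∘tabulate (h ∘ toℕ) (fromℕ< i<k)) (cong h (toℕ-fromℕ< i<k)))

<2+ : ∀ {j m} → j < m → j < 2 + m
<2+ = ℕP.m≤n⇒m≤o+n 2

<∸1 : ∀ {i m} → suc i < m → i < m ∸ 1
<∸1 {m = suc m} (s≤s i<m) = i<m

∸1< : ∀ {i m} → i < m ∸ 1 → suc i < m
∸1< {m = suc m} i<m = s≤s i<m

dirAt-induced : ∀ {m} (C : Config m) {i} → suc i < m → dirAt (induced C) i ≡ slope (get C i) (get C (suc i))
dirAt-induced {m} C {i} si<m = begin
  dirAt (induced C) i                        ≡⟨ dirAt-tabulate (λ j → cmpDir (atM C j) (atM C (suc j))) (<∸1 si<m) ⟩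
  cmpDir (atM C i) (atM C (suc i))           ≡⟨ cong₂ cmpDir (atM-get C i) (atM-get C (suc i)) ⟩
  cmpDir (at m X i) (at m X (suc i))         ≡⟨ cong₂ cmpDir (at-in (ℕP.<-trans (ℕP.n<1+n i) si<m)) (at-in si<m) ⟩
  slope (X i) (X (suc i))                    ∎
  where
  open ≡-Reasoning
  X = get C

record Rooted (m : ℕ) (R : Orientation m) (X : ℕ → ℤ) : Set where
  field
    period2 : diffuse m (diffuse m X) ≈⟨ m ⟩ X
    moving  : ¬ diffuse m X ≈⟨ m ⟩ X
    root    : at m X 0 ≡ just (+ 0)
    induces : ∀ i → suc i < m → slope (X i) (X (suc i)) ≡ dirAt R i

Rooted-cong : ∀ {m R f g} → f ≈⟨ m ⟩ g → Rooted m R f → Rooted m R g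
Rooted-cong {m} {R} {f} {g} f≈g rf = record
  { period2 = ≈-trans (≈-sym (diffuse-cong (diffuse-cong f≈g))) (≈-trans period2 f≈g)
  ; moving  = λ g-fixed → moving (≈-trans (diffuse-cong f≈g) (≈-trans g-fixed (≈-sym f≈g)))
  ; root    = trans (sym (at-cong f≈g 0)) root
  ; induces = λ i si<m → trans (sym (cong₂ slope (f≈g i (ℕP.<-trans (ℕP.n<1+n i) si<m)) (f≈g (suc i) si<m))) (induces i si<m)
  }
  where open Rooted rf

get-step² : ∀ {m} (C : Config m) → get (step (step C)) ≈⟨ m ⟩ diffuse m (diffuse m (get C))
get-step² C = ≈-trans (get-step (step C)) (diffuse-cong (get-step C))

get-period2 : ∀ {m} {C : Config m} → IsP2 C → diffuse m (diffuse m (get C)) ≈⟨ m ⟩ get C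
get-period2 {C = C} isP2 = ≈-trans (≈-sym (get-step² C)) (λ i _ → cong (λ D → get D i) (proj₁ (isP2-elim isP2)))

get-induces : ∀ {m R} {C : Config m} → induced C ≡ R → ∀ i → suc i < m → slope (get C i) (get C (suc i)) ≡ dirAt R i
get-induces {C = C} refl i si<m = sym (dirAt-induced C si<m)

P2Rooted⇒Rooted : ∀ {m R} {C : Config m} → P2Rooted m R C → Rooted m R (get C)
P2Rooted⇒Rooted {m} {R} {C} (isP2 , root , induced≡R) = record
  { period2 = get-period2 isP2
  ; moving  = λ fixed → proj₂ (isP2-elim isP2) (get-injective (≈-trans (get-step C) fixed))
  ; root    = trans (sym (atM-get C 0)) root
  ; induces = get-induces induced≡R
  }

Rooted⇒P2Rooted : ∀ {m R} {C : Config m} → Rooted m R (get C) → P2Rooted m R C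
Rooted⇒P2Rooted {m} {R} {C} rC =
  isP2-intro (get-injective (≈-trans (get-step² C) period2)) moves ,
  trans (atM-get C 0) root ,
  dirAt-ext (λ i i<m-1 → trans (dirAt-induced C (∸1< i<m-1)) (induces i (∸1< i<m-1)))
  where
  open Rooted rC
  moves : ¬ step C ≡ C
  moves fixed = moving (≈-trans (≈-sym (get-step C)) (λ i _ → cong (λ D → get D i) fixed))

module _ {m : ℕ} {X : ℕ → ℤ} where

  left-end : ∀ {d} → Directed d → ∀ a → a < m → cmpDir (just (X a)) (leftOf m X a) ≡ d →
    ∃ λ b → a ≡ suc b × slope (X a) (X b) ≡ d
  left-end dd zero _ flat≡d = contradiction flat≡d (flat-undirected dd)
  left-end dd (suc b) sb<m a→b =
    b , refl , trans (cong (cmpDir (just (X (suc b)))) (sym (at-in (ℕP.<-trans (ℕP.n<1+n b) sb<m)))) a→b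

  right-end : ∀ {d} → Directed d → ∀ i → cmpDir (just (X i)) (at m X (suc i)) ≡ d →
    suc i < m × slope (X i) (X (suc i)) ≡ d
  right-end dd i i→ with suc i <? m
  ... | yes si<m = si<m , trans (cong (cmpDir (just (X i))) (sym (at-in si<m))) i→
  ... | no si≮m = contradiction (trans (cong (cmpDir (just (X i))) (sym (at-out si≮m))) i→) (flat-undirected dd)

leftOf-pull : ∀ {m f a b e} → a ≡ suc b → a < m → slope (f b) (f a) ≡ rev e → cmpDir (just (f a)) (leftOf m f a) ≡ e
leftOf-pull {m} {f} {e = e} refl a<m b→a = begin
  cmpDir (just (f _)) (at m f _)      ≡⟨ cong (cmpDir (just (f _))) (at-in (ℕP.<-trans (ℕP.n<1+n _) a<m)) ⟩
  slope (f _) (f _)                   ≡⟨ slope-swap (f _) (f _) ⟩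
  rev (slope (f _) (f _))             ≡⟨ cong rev b→a ⟩
  rev (rev e)                         ≡⟨ rev-involutive e ⟩
  e                                   ∎
  where open ≡-Reasoning

record Staircase (m : ℕ) (X : ℕ → ℤ) (d : Dir) (a : ℕ) : Set where
  field
    b       : ℕ
    a≡1+b   : a ≡ suc b
    room    : 3 + a < m
    before  : slope (X a) (X b) ≡ d
    after   : slope (X (2 + a)) (X (3 + a)) ≡ rev d
    rise₁   : X (suc a) ≡ X a ℤ.+ ⟦ d ⟧
    rise₂   : X (2 + a) ≡ X (suc a) ℤ.+ ⟦ d ⟧
    jump    : diffuse m X a ≡ (X a ℤ.+ ⟦ d ⟧) ℤ.+ ⟦ d ⟧
    drop    : diffuse m X (2 + a) ≡ X a

module Period2 {m : ℕ} {X : ℕ → ℤ} (period2 : diffuse m (diffuse m X) ≈⟨ m ⟩ X) where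

  private
    Y = diffuse m X

    pullˡ : (ℕ → ℤ) → ℕ → ℤ
    pullˡ f i = ⟦ cmpDir (just (f i)) (leftOf m f i) ⟧

    pullˡ-suc : ∀ f {j} → j < m → pullˡ f (suc j) ≡ ℤ.- ⟦ slope (f j) (f (suc j)) ⟧
    pullˡ-suc f {j} j<m = begin
      ⟦ cmpDir (just (f (suc j))) (at m f j) ⟧   ≡⟨ cong (λ l → ⟦ cmpDir (just (f (suc j))) l ⟧) (at-in j<m) ⟩
      ⟦ slope (f (suc j)) (f j) ⟧                ≡⟨ cong ⟦_⟧ (slope-swap (f j) (f (suc j))) ⟩
      ⟦ rev (slope (f j) (f (suc j))) ⟧          ≡⟨ ⟦rev⟧ _ ⟩
      ℤ.- ⟦ slope (f j) (f (suc j)) ⟧            ∎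
      where open ≡-Reasoning

    cancel-pulls : ∀ x a s b t → (((x ℤ.+ a) ℤ.+ s) ℤ.+ b) ℤ.+ t ≡ x → a ℤ.+ b ≡ + 0 → t ≡ ℤ.- s
    cancel-pulls x a s b t round-trip a+b≡0 = begin
      t                                                                  ≡⟨ isolate x a s b t ⟩
      ((((x ℤ.+ a) ℤ.+ s) ℤ.+ b) ℤ.+ t) ℤ.- x ℤ.- (a ℤ.+ b) ℤ.- s
                      ≡⟨ cong₂ (λ u v → u ℤ.- x ℤ.- v ℤ.- s) round-trip a+b≡0 ⟩
      x ℤ.- x ℤ.- + 0 ℤ.- s                                              ≡⟨ collapse x s ⟩
      ℤ.- s                                                              ∎
      where
      open ≡-Reasoning
      isolate : ∀ x a s b t → t ≡ ((((x ℤ.+ a) ℤ.+ s) ℤ.+ b) ℤ.+ t) ℤ.- x ℤ.- (a ℤ.+ b) ℤ.- s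
      isolate = solve-∀
      collapse : ∀ x s → x ℤ.- x ℤ.- + 0 ℤ.- s ≡ ℤ.- s
      collapse = solve-∀

  -- Over two steps every vertex regains its height. Inductively from v₁, what a vertex receives from
  -- its left neighbour cancels over the two steps, hence so does what it receives from the right.
  flip : ∀ i → suc i < m → slope (Y i) (Y (suc i)) ≡ rev (slope (X i) (X (suc i)))
  flip i si<m = ⟦⟧-injective (trans (right-pull-flips i si<m) (sym (⟦rev⟧ _)))
    where
    right-pull-flips : ∀ i → suc i < m → ⟦ slope (Y i) (Y (suc i)) ⟧ ≡ ℤ.- ⟦ slope (X i) (X (suc i)) ⟧
    left-pulls-cancel : ∀ i → suc i < m → pullˡ X i ℤ.+ pullˡ Y i ≡ + 0

    right-pull-flips i si<m =
      cancel-pulls (X i) (pullˡ X i) (⟦ slope (X i) (X (suc i)) ⟧) (pullˡ Y i) (⟦ slope (Y i) (Y (suc i)) ⟧)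
        (trans (cong (λ y → (y ℤ.+ pullˡ Y i) ℤ.+ ⟦ slope (Y i) (Y (suc i)) ⟧) (sym (diffuse-inner {m} {X} si<m)))
               (trans (sym (diffuse-inner {m} {Y} si<m)) (period2 i (ℕP.<-trans (ℕP.n<1+n i) si<m))))
        (left-pulls-cancel i si<m)

    left-pulls-cancel zero _ = refl
    left-pulls-cancel (suc j) ssj<m = begin
      pullˡ X (suc j) ℤ.+ pullˡ Y (suc j)        ≡⟨ cong₂ ℤ._+_ (pullˡ-suc X j<m) (pullˡ-suc Y j<m) ⟩
      ℤ.- s ℤ.+ ℤ.- ⟦ slope (Y j) (Y (suc j)) ⟧  ≡⟨ cong (λ t → ℤ.- s ℤ.+ ℤ.- t) (right-pull-flips j sj<m) ⟩
      ℤ.- s ℤ.+ ℤ.- ℤ.- s                         ≡⟨ opposite s ⟩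
      + 0                                         ∎
      where
      open ≡-Reasoning
      sj<m = ℕP.<-trans (ℕP.n<1+n (suc j)) ssj<m
      j<m = ℕP.<-trans (ℕP.n<1+n j) sj<m
      s = ⟦ slope (X j) (X (suc j)) ⟧
      opposite : ∀ s → ℤ.- s ℤ.+ ℤ.- ℤ.- s ≡ + 0
      opposite = solve-∀

  -- Each of the two flips, read through rigidity, pins down one outer neighbour.
  staircase : ∀ {d a} → Directed d → 2 + a < m →
    slope (X a) (X (suc a)) ≡ d → slope (X (suc a)) (X (2 + a)) ≡ d → Staircase m X d a
  staircase {d} {a} dd ssa<m a→ sa→ = record
    { b = proj₁ left-side ; a≡1+b = proj₁ (proj₂ left-side) ; before = proj₂ (proj₂ left-side)
    ; room = proj₁ right-side ; after = proj₂ right-side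
    ; rise₁ = proj₂ left-rigid ; rise₂ = proj₂ right-rigid
    ; jump = trans Ya (cong (λ e → (X a ℤ.+ ⟦ e ⟧) ℤ.+ ⟦ d ⟧) (proj₁ left-rigid))
    ; drop = trans Yssa (trans (cong (λ e → (X (2 + a) ℤ.+ ⟦ rev d ⟧) ℤ.+ ⟦ e ⟧) (proj₁ right-rigid))
                              (trans (cong (λ x → (x ℤ.+ ⟦ rev d ⟧) ℤ.+ ⟦ rev d ⟧) X[2+a])
                                     (trans (cong (ℤ._+ ⟦ rev d ⟧) (step-back d (X a ℤ.+ ⟦ d ⟧))) (step-back d (X a)))))
    }
    where
    sa<m = ℕP.<-trans (ℕP.n<1+n (suc a)) ssa<m
    eˡ = cmpDir (just (X a)) (leftOf m X a)
    eʳ = cmpDir (just (X (2 + a))) (at m X (3 + a))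
    sa←ssa : slope (X (2 + a)) (X (suc a)) ≡ rev d
    sa←ssa = trans (slope-swap (X (suc a)) (X (2 + a))) (cong rev sa→)
    Ysa : Y (suc a) ≡ X (suc a)
    Ysa = trans (diffuse-interior {m} {X} ssa<m)
                (trans (cong₂ (λ l r → (X (suc a) ℤ.+ ⟦ l ⟧) ℤ.+ ⟦ r ⟧)
                              (trans (slope-swap (X a) (X (suc a))) (cong rev a→)) sa→)
                       (pull-cancel d (X (suc a))))
    Ya : Y a ≡ (X a ℤ.+ ⟦ eˡ ⟧) ℤ.+ ⟦ d ⟧
    Ya = trans (diffuse-inner {m} {X} sa<m) (cong (λ r → (X a ℤ.+ ⟦ eˡ ⟧) ℤ.+ ⟦ r ⟧) a→)
    Yssa : Y (2 + a) ≡ (X (2 + a) ℤ.+ ⟦ rev d ⟧) ℤ.+ ⟦ eʳ ⟧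
    Yssa = trans (cong (λ l → (X (2 + a) ℤ.+ ⟦ cmpDir (just (X (2 + a))) l ⟧) ℤ.+ ⟦ eʳ ⟧) (at-in sa<m))
                 (cong (λ r → (X (2 + a) ℤ.+ ⟦ r ⟧) ℤ.+ ⟦ eʳ ⟧) sa←ssa)
    left-rigid : eˡ ≡ d × X (suc a) ≡ X a ℤ.+ ⟦ d ⟧
    left-rigid = rigidity dd eˡ {X a} {X (suc a)} a→
      (subst₂ (λ u v → slope u v ≡ rev d) Ya Ysa (trans (flip a sa<m) (cong rev a→)))
    right-rigid : eʳ ≡ rev d × X (2 + a) ≡ X (suc a) ℤ.+ ⟦ d ⟧
    right-rigid = rigidity-right dd eʳ {X (suc a)} {X (2 + a)} sa→
      (subst₂ (λ u v → slope u v ≡ rev d) Ysa Yssa (trans (flip (suc a) ssa<m) (cong rev sa→)))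
    left-side = left-end dd a (ℕP.<-trans (ℕP.n<1+n a) sa<m) (proj₁ left-rigid)
    right-side = right-end (rev-directed dd) (2 + a) (proj₁ right-rigid)
    X[2+a] : X (2 + a) ≡ (X a ℤ.+ ⟦ d ⟧) ℤ.+ ⟦ d ⟧
    X[2+a] = trans (proj₂ right-rigid) (cong (ℤ._+ ⟦ d ⟧) (proj₂ left-rigid))

opaque
  splice : ℕ → (ℕ → ℤ) → (ℕ → ℤ) → ℕ → ℤ
  splice a f g i with i ≤? a
  ... | yes _ = f i
  ... | no _ = g i

  splice-≤ : ∀ {a f g i} → i ≤ a → splice a f g i ≡ f i
  splice-≤ {a} {i = i} i≤a with i ≤? a
  ... | yes _ = refl
  ... | no i≰a = contradiction i≤a i≰a

  splice-> : ∀ {a f g i} → a < i → splice a f g i ≡ g i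
  splice-> {a} {i = i} a<i with i ≤? a
  ... | yes i≤a = contradiction a<i (ℕP.≤⇒≯ i≤a)
  ... | no _ = refl

-- With a = k - 1 the position of v_k, collapse a X Y deletes v_{k+1}, v_{k+2} and reads v_{k+3},… from Y;
-- expand a d X Y inserts a unit ramp in direction d after v_k and reads the rest from Y.
opaque
  collapse : ℕ → (ℕ → ℤ) → (ℕ → ℤ) → ℕ → ℤ
  collapse a X Y = splice a X (λ i → Y (2 + i))

  expand : ℕ → Dir → (ℕ → ℤ) → (ℕ → ℤ) → ℕ → ℤ
  expand a d X Y = splice a X (splice (suc a) (λ _ → X a ℤ.+ ⟦ d ⟧)
                     (splice (2 + a) (λ _ → (X a ℤ.+ ⟦ d ⟧) ℤ.+ ⟦ d ⟧) (λ i → Y (i ∸ 2))))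

  collapse-≤ : ∀ {a X Y i} → i ≤ a → collapse a X Y i ≡ X i
  collapse-≤ = splice-≤

  collapse-> : ∀ {a X Y i} → a < i → collapse a X Y i ≡ Y (2 + i)
  collapse-> = splice->

  expand-≤ : ∀ {a d X Y i} → i ≤ a → expand a d X Y i ≡ X i
  expand-≤ = splice-≤

  expand-1 : ∀ {a d X Y} → expand a d X Y (suc a) ≡ X a ℤ.+ ⟦ d ⟧
  expand-1 {a} = trans (splice-> (ℕP.n<1+n a)) (splice-≤ ℕP.≤-refl)

  expand-2 : ∀ {a d X Y} → expand a d X Y (2 + a) ≡ (X a ℤ.+ ⟦ d ⟧) ℤ.+ ⟦ d ⟧
  expand-2 {a} = trans (splice-> (ℕP.<-trans (ℕP.n<1+n a) (ℕP.n<1+n (suc a))))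
                       (trans (splice-> (ℕP.n<1+n (suc a))) (splice-≤ ℕP.≤-refl))

  expand-> : ∀ {a d X Y k} → a < k → expand a d X Y (2 + k) ≡ Y k
  expand-> a<k = trans (splice-> (ℕP.<-trans a<k (ℕP.<-trans (ℕP.n<1+n _) (ℕP.n<1+n _))))
                   (trans (splice-> (s≤s (ℕP.<-trans a<k (ℕP.n<1+n _)))) (splice-> (s≤s (s≤s a<k))))

data Around (a : ℕ) : ℕ → Set where
  below  : ∀ {i} → i < a → Around a i
  at₀    : Around a a
  at₁    : Around a (suc a)
  at₂    : Around a (2 + a)
  above  : ∀ {k} → a < k → Around a (2 + k)

around : ∀ a i → Around a i
around a i with ℕP.<-cmp i a
... | tri< i<a _ _ = below i<a
... | tri≈ _ refl _ = at₀
around a (suc i) | tri> _ _ a<si with ℕP.<-cmp i a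
... | tri< i<a _ _ = contradiction a<si (ℕP.≤⇒≯ i<a)
... | tri≈ _ refl _ = at₁
around a (suc (suc k)) | tri> _ _ _ | tri> _ _ a<k+1 with ℕP.<-cmp k a
... | tri< k<a _ _ = contradiction a<k+1 (ℕP.≤⇒≯ k<a)
... | tri≈ _ refl _ = at₂
... | tri> _ _ a<k = above a<k

collapse-≥ : ∀ {a X Y j} → Y (2 + a) ≡ X a → a ≤ j → collapse a X Y j ≡ Y (2 + j)
collapse-≥ {a} {X} {Y} {j} Y[2+a] a≤j with ℕP.m≤n⇒m<n∨m≡n a≤j
... | inj₁ a<j = collapse-> a<j
... | inj₂ refl = trans (collapse-≤ ℕP.≤-refl) (sym Y[2+a])

expand-≥ : ∀ {a d X Y k} → Y a ≡ (X a ℤ.+ ⟦ d ⟧) ℤ.+ ⟦ d ⟧ → a ≤ k → expand a d X Y (2 + k) ≡ Y k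
expand-≥ {a} {d} {X} {Y} {k} Ya a≤k with ℕP.m≤n⇒m<n∨m≡n a≤k
... | inj₁ a<k = expand-> a<k
... | inj₂ refl = trans expand-2 (sym Ya)

collapse-cong : ∀ {m' a X X' Y Y'} → X ≈⟨ 2 + m' ⟩ X' → Y ≈⟨ 2 + m' ⟩ Y' →
  collapse a X Y ≈⟨ m' ⟩ collapse a X' Y'
collapse-cong {m'} {a} {X} {X'} {Y} {Y'} X≈X' Y≈Y' i i<m' with i ≤? a
... | yes i≤a = trans (collapse-≤ {a} {X} {Y} i≤a)
                  (trans (X≈X' i (<2+ i<m'))
                         (sym (collapse-≤ {a} {X'} {Y'} i≤a)))
... | no i≰a = trans (collapse-> {a} {X} {Y} (ℕP.≰⇒> i≰a))
                 (trans (Y≈Y' (2 + i) (s≤s (s≤s i<m'))) (sym (collapse-> {a} {X'} {Y'} (ℕP.≰⇒> i≰a))))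

expand-cong : ∀ {m' a d X X' Y Y'} → a < m' → X ≈⟨ m' ⟩ X' → Y ≈⟨ m' ⟩ Y' →
  expand a d X Y ≈⟨ 2 + m' ⟩ expand a d X' Y'
expand-cong {m'} {a} {d} {X} {X'} {Y} {Y'} a<m' X≈X' Y≈Y' i i<n = go i (around a i) i<n
  where
  Xa≡ : X a ≡ X' a
  Xa≡ = X≈X' a a<m'
  lower : ∀ {i} → i ≤ a → expand a d X Y i ≡ expand a d X' Y' i
  lower i≤a = trans (expand-≤ i≤a) (trans (X≈X' _ (ℕP.≤-<-trans i≤a a<m')) (sym (expand-≤ i≤a)))
  go : ∀ i → Around a i → i < 2 + m' → expand a d X Y i ≡ expand a d X' Y' i
  go i (below i<a) _ = lower (ℕP.<⇒≤ i<a)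
  go .a at₀ _ = lower ℕP.≤-refl
  go .(suc a) at₁ _ = trans expand-1 (trans (cong (ℤ._+ ⟦ d ⟧) Xa≡) (sym expand-1))
  go .(2 + a) at₂ _ = trans expand-2 (trans (cong (λ x → (x ℤ.+ ⟦ d ⟧) ℤ.+ ⟦ d ⟧) Xa≡) (sym expand-2))
  go .(2 + k) (above {k} a<k) (s≤s (s≤s k<m')) = trans (expand-> a<k) (trans (Y≈Y' k k<m') (sym (expand-> a<k)))

collapse-diffuse : ∀ {m' a X Y Z} → Y ≈⟨ 2 + m' ⟩ diffuse (2 + m') X → Z ≈⟨ 2 + m' ⟩ diffuse (2 + m') Y →
  suc a < m' → Y (2 + a) ≡ X a → slope (X a) (Y (3 + a)) ≡ slope (X a) (X (suc a)) →
  diffuse m' (collapse a X Y) ≈⟨ m' ⟩ collapse a Y Z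
collapse-diffuse {m'} {a} {X} {Y} {Z} Y≈ Z≈ sa<m' Y[2+a] a→ i i<m' = go i (i ≤? a) i<m'
  where
  open ≡-Reasoning
  n = 2 + m'
  C = collapse a X Y
  a<m' = ℕP.<-trans (ℕP.n<1+n a) sa<m'
  a<n = <2+ a<m'

  right-pull : cmpDir (just (C a)) (at m' C (suc a)) ≡ cmpDir (just (X a)) (at n X (suc a))
  right-pull = begin
    cmpDir (just (C a)) (at m' C (suc a))   ≡⟨ cong₂ (λ x → cmpDir (just x)) (collapse-≤ ℕP.≤-refl) (at-in sa<m') ⟩
    slope (X a) (C (suc a))                 ≡⟨ cong (slope (X a)) (collapse-> (ℕP.n<1+n a)) ⟩
    slope (X a) (Y (3 + a))                 ≡⟨ a→ ⟩
    slope (X a) (X (suc a))                 ≡⟨ cong (cmpDir (just (X a))) (at-in (<2+ sa<m')) ⟨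
    cmpDir (just (X a)) (at n X (suc a))    ∎

  tail : ∀ k → a ≤ k → Y (2 + k) ≡ C k
  tail k a≤k = sym (collapse-≥ Y[2+a] a≤k)

  go : ∀ i → Dec (i ≤ a) → i < m' → diffuse m' C i ≡ collapse a Y Z i
  go i (yes i≤a) i<m' = begin
    diffuse m' C i      ≡⟨ diffuse-prefix (λ _ → collapse-≤) a<m' a<n right-pull i i≤a ⟩
    diffuse n X i       ≡⟨ Y≈ i (<2+ i<m') ⟨
    Y i                 ≡⟨ collapse-≤ i≤a ⟨
    collapse a Y Z i    ∎
  go (suc j) (no sj≰a) sj<m' = begin
    diffuse m' C (suc j)        ≡⟨ diffuse-shift {a} {m'} {C} {Y} tail j a≤j ⟨
    diffuse n Y (2 + suc j)     ≡⟨ Z≈ (2 + suc j) (s≤s (s≤s sj<m')) ⟨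
    Z (2 + suc j)               ≡⟨ collapse-> (s≤s a≤j) ⟨
    collapse a Y Z (suc j)      ∎
    where a≤j = ℕP.≤-pred (ℕP.≰⇒> sj≰a)
  go zero (no 0≰a) _ = contradiction z≤n 0≰a

expand-diffuse : ∀ {m' a d X Y Z} → Directed d → Y ≈⟨ m' ⟩ diffuse m' X → Z ≈⟨ m' ⟩ diffuse m' Y → suc a < m' →
  cmpDir (just (X a)) (leftOf m' X a) ≡ d → slope (X a) (X (suc a)) ≡ d → slope (Y a) (Y (suc a)) ≡ rev d →
  diffuse (2 + m') (expand a d X Y) ≈⟨ 2 + m' ⟩ expand a (rev d) Y Z
expand-diffuse {m'} {a} {d} {X} {Y} {Z} dd Y≈ Z≈ sa<m' ←a a→ Ya→ i i<n = go i (around a i) i<n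
  where
  open ≡-Reasoning
  n = 2 + m'
  E = expand a d X Y
  x = X a
  a<m' = ℕP.<-trans (ℕP.n<1+n a) sa<m'
  a<n = <2+ a<m'

  Ya : Y a ≡ (x ℤ.+ ⟦ d ⟧) ℤ.+ ⟦ d ⟧
  Ya = trans (Y≈ a a<m') (diffuse-pulled {m'} {X} sa<m' ←a a→)

  tail : ∀ k → a ≤ k → E (2 + k) ≡ Y k
  tail k a≤k = expand-≥ Ya a≤k

  right-pull : cmpDir (just (E a)) (at n E (suc a)) ≡ cmpDir (just x) (at m' X (suc a))
  right-pull = begin
    cmpDir (just (E a)) (at n E (suc a))   ≡⟨ cong₂ (λ x → cmpDir (just x)) (expand-≤ ℕP.≤-refl) (at-in (<2+ sa<m')) ⟩
    slope x (E (suc a))                    ≡⟨ cong (slope x) expand-1 ⟩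
    slope x (x ℤ.+ ⟦ d ⟧)                  ≡⟨ slope-step dd x ⟩
    d                                      ≡⟨ a→ ⟨
    slope x (X (suc a))                    ≡⟨ cong (cmpDir (just x)) (at-in sa<m') ⟨
    cmpDir (just x) (at m' X (suc a))      ∎

  lower : ∀ i → i ≤ a → diffuse n E i ≡ expand a (rev d) Y Z i
  lower i i≤a = begin
    diffuse n E i               ≡⟨ diffuse-prefix (λ _ → expand-≤) a<n a<m' right-pull i i≤a ⟩
    diffuse m' X i              ≡⟨ Y≈ i (ℕP.≤-<-trans i≤a a<m') ⟨
    Y i                         ≡⟨ expand-≤ i≤a ⟨
    expand a (rev d) Y Z i      ∎

  go : ∀ i → Around a i → i < n → diffuse n E i ≡ expand a (rev d) Y Z i
  go i (below i<a) _ = lower i (ℕP.<⇒≤ i<a)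
  go .a at₀ _ = lower a ℕP.≤-refl
  go .(suc a) at₁ _ = begin
    diffuse n E (suc a)
      ≡⟨ diffuse-interior-≡ {n} {E} (s≤s (s≤s a<m')) expand-1 (expand-≤ ℕP.≤-refl) expand-2 ⟩
    (x ℤ.+ ⟦ d ⟧ ℤ.+ ⟦ slope (x ℤ.+ ⟦ d ⟧) x ⟧) ℤ.+ ⟦ slope (x ℤ.+ ⟦ d ⟧) ((x ℤ.+ ⟦ d ⟧) ℤ.+ ⟦ d ⟧) ⟧
      ≡⟨ ramp-middle dd x ⟩
    ((x ℤ.+ ⟦ d ⟧) ℤ.+ ⟦ d ⟧) ℤ.+ ⟦ rev d ⟧
      ≡⟨ cong (ℤ._+ ⟦ rev d ⟧) Ya ⟨
    Y a ℤ.+ ⟦ rev d ⟧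
      ≡⟨ expand-1 ⟨
    expand a (rev d) Y Z (suc a) ∎
  go .(2 + a) at₂ _ = begin
    diffuse n E (2 + a)
      ≡⟨ diffuse-interior-≡ {n} {E} (s≤s (s≤s sa<m')) (trans expand-2 (sym Ya)) expand-1 (expand-> (ℕP.n<1+n a)) ⟩
    (Y a ℤ.+ ⟦ slope (Y a) (x ℤ.+ ⟦ d ⟧) ⟧) ℤ.+ ⟦ slope (Y a) (Y (suc a)) ⟧
      ≡⟨ cong₂ (λ l r → (Y a ℤ.+ ⟦ l ⟧) ℤ.+ ⟦ r ⟧)
               (trans (cong (λ y → slope y (x ℤ.+ ⟦ d ⟧)) Ya) (slope-step-back dd (x ℤ.+ ⟦ d ⟧))) Ya→ ⟩
    (Y a ℤ.+ ⟦ rev d ⟧) ℤ.+ ⟦ rev d ⟧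
      ≡⟨ expand-2 ⟨
    expand a (rev d) Y Z (2 + a) ∎
  go .(2 + suc j) (above {suc j} (s≤s a≤j)) (s≤s (s≤s sj<m')) = begin
    diffuse n E (2 + suc j)              ≡⟨ diffuse-shift {a} {m'} {Y} {E} tail j a≤j ⟩
    diffuse m' Y (suc j)                 ≡⟨ Z≈ (suc j) sj<m' ⟨
    Z (suc j)                            ≡⟨ expand-> (s≤s a≤j) ⟨
    expand a (rev d) Y Z (2 + suc j)     ∎

HasCount-transfer : ∀ {A B : Set} {P : A → Set} {Q : B → Set} (f : A → B) (g : B → A) →
  (∀ {x} → P x → Q (f x)) → (∀ {y} → Q y → P (g y)) →
  (∀ {x} → P x → g (f x) ≡ x) → (∀ {y} → Q y → f (g y) ≡ y) →
  ∀ {k} → HasCount P k → HasCount Q k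
HasCount-transfer f g f-Q g-P g∘f f∘g (xs , length≡k , unique , all-P , complete) =
  map f xs ,
  trans (length-map f xs) length≡k ,
  Unique.map⁻ (subst Unique (sym g∘f[xs]) unique) ,
  All.map⁺ (All.map f-Q all-P) ,
  λ y Qy → subst (_∈ map f xs) (f∘g Qy) (∈-map⁺ f (complete (g y) (g-P Qy)))
  where
  g∘f[xs] : map g (map f xs) ≡ xs
  g∘f[xs] = trans (sym (map-∘ xs)) (map-id-local (All.map g∘f all-P))

module _ {m : ℕ} (R : Vec Dir m) (a : ℕ) where

  contractDir-< : ∀ {j} → j < a → contractDir R (suc a) j ≡ dirAt R j
  contractDir-< {j} j<a with suc j <? suc a
  ... | yes _ = refl
  ... | no sj≮sa = contradiction (s≤s j<a) sj≮sa

  contractDir-≥ : ∀ {j} → a ≤ j → contractDir R (suc a) j ≡ rev (dirAt R (2 + j))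
  contractDir-≥ {j} a≤j with suc j <? suc a
  ... | yes sj<sa = contradiction a≤j (ℕP.<⇒≱ (ℕP.≤-pred sj<sa))
  ... | no _ with j <? suc a
  ...   | yes j<sa = cong (λ i → rev (dirAt R (2 + i))) (ℕP.≤-antisym a≤j (ℕP.≤-pred j<sa))
  ...   | no _ = cong (λ i → rev (dirAt R i)) (ℕP.+-comm j 2)

dirAt-contract : ∀ {m'} (R : Orientation (2 + m')) k {j} → suc j < m' →
  dirAt (contract (2 + m') R k) j ≡ contractDir R k j
dirAt-contract R k sj<m' = dirAt-tabulate (contractDir R k) (<∸1 sj<m')

record OrientedStaircase (n : ℕ) (R : Orientation n) (d : Dir) (a : ℕ) : Set where
  field
    b       : ℕ
    a≡1+b   : a ≡ suc b
    room    : 3 + a < n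
    before  : dirAt R b ≡ rev d
    step₀   : dirAt R a ≡ d
    step₁   : dirAt R (suc a) ≡ d
    after   : dirAt R (2 + a) ≡ rev d

oriented-staircase : ∀ {n R d a} → Directed d → IsP2Orientation n R → 2 + a < n →
  dirAt R a ≡ d → dirAt R (suc a) ≡ d → OrientedStaircase n R d a
oriented-staircase {n} {R} {d} {a} dd (C , isP2 , induced≡R) ssa<n a→ sa→ = record
  { b = b ; a≡1+b = a≡1+b ; room = room ; step₀ = a→ ; step₁ = sa→
  ; before = trans (sym (induces b b<n))
               (trans (cong (λ i → slope (X b) (X i)) (sym a≡1+b)) (trans (slope-swap (X a) (X b)) (cong rev before′)))
  ; after = trans (sym (induces (2 + a) room)) after′
  }
  where
  X = get C
  induces = get-induces induced≡R
  sa<n = ℕP.<-trans (ℕP.n<1+n (suc a)) ssa<n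
  S : Staircase n X d a
  S = Period2.staircase (get-period2 isP2) dd ssa<n (trans (induces a sa<n) a→) (trans (induces (suc a) ssa<n) sa→)
  open Staircase S renaming (before to before′; after to after′)
  b<n : suc b < n
  b<n = subst (_< n) a≡1+b (ℕP.<-trans (ℕP.n<1+n a) sa<n)

module Contraction {m' a : ℕ} {d : Dir} (dd : Directed d) (R : Orientation (2 + m'))
                   (shape : OrientedStaircase (2 + m') R d a) where

  open OrientedStaircase shape
  open ≡-Reasoning

  n = 2 + m'
  R' = contract n R (suc a)


  sa<m' : suc a < m'
  sa<m' = ℕP.≤-pred (ℕP.≤-pred room)

  a<m' : a < m'
  a<m' = ℕP.<-trans (ℕP.n<1+n a) sa<m'

  a<n : a < n
  a<n = <2+ a<m'

  Φ : (ℕ → ℤ) → ℕ → ℤ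
  Φ X = collapse a X (diffuse n X)

  Ψ : (ℕ → ℤ) → ℕ → ℤ
  Ψ X′ = expand a d X′ (diffuse m' X′)

  module Forward {X : ℕ → ℤ} (rX : Rooted n R X) where

    private
      module X = Rooted rX
      Y = diffuse n X
      flip = Period2.flip X.period2
      a→ : slope (X a) (X (suc a)) ≡ d
      a→ = trans (X.induces a (<2+ sa<m')) step₀
      module S = Staircase (Period2.staircase X.period2 dd (s≤s (s≤s a<m')) a→
                                              (trans (X.induces (suc a) (s≤s (s≤s a<m'))) step₁))

      X[2+a] : X (2 + a) ≡ Y a
      X[2+a] = trans S.rise₂ (trans (cong (ℤ._+ ⟦ d ⟧) S.rise₁) (sym S.jump))

      outward : slope (X a) (Y (3 + a)) ≡ slope (X a) (X (suc a))
      outward = begin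
        slope (X a) (Y (3 + a))                   ≡⟨ cong (λ x → slope x (Y (3 + a))) S.drop ⟨
        slope (Y (2 + a)) (Y (3 + a))             ≡⟨ flip (2 + a) S.room ⟩
        rev (slope (X (2 + a)) (X (3 + a)))       ≡⟨ cong rev S.after ⟩
        rev (rev d)                               ≡⟨ rev-involutive d ⟩
        d                                         ≡⟨ a→ ⟨
        slope (X a) (X (suc a))                   ∎

      outward′ : slope (Y a) (X (3 + a)) ≡ slope (Y a) (Y (suc a))
      outward′ = begin
        slope (Y a) (X (3 + a))                   ≡⟨ cong (λ x → slope x (X (3 + a))) X[2+a] ⟨
        slope (X (2 + a)) (X (3 + a))             ≡⟨ S.after ⟩
        rev d                                     ≡⟨ cong rev a→ ⟨
        rev (slope (X a) (X (suc a)))             ≡⟨ flip a (<2+ sa<m') ⟨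
        slope (Y a) (Y (suc a))                   ∎

    diffuse-Φ : diffuse m' (Φ X) ≈⟨ m' ⟩ collapse a Y X
    diffuse-Φ = collapse-diffuse (λ _ _ → refl) (≈-sym X.period2) sa<m' S.drop outward

    private
      diffuse-collapse : diffuse m' (collapse a Y X) ≈⟨ m' ⟩ Φ X
      diffuse-collapse = collapse-diffuse (≈-sym X.period2) (λ _ _ → refl) sa<m' X[2+a] outward′

      induces : ∀ j → suc j < m' → slope (Φ X j) (Φ X (suc j)) ≡ dirAt R' j
      induces j sj<m' with j <? a
      ... | yes j<a = begin
        slope (Φ X j) (Φ X (suc j))     ≡⟨ cong₂ slope (collapse-≤ (ℕP.<⇒≤ j<a)) (collapse-≤ j<a) ⟩
        slope (X j) (X (suc j))         ≡⟨ X.induces j (<2+ sj<m') ⟩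
        dirAt R j                       ≡⟨ contractDir-< R a j<a ⟨
        contractDir R (suc a) j         ≡⟨ dirAt-contract R (suc a) sj<m' ⟨
        dirAt R' j                      ∎
      ... | no j≮a = begin
        slope (Φ X j) (Φ X (suc j))     ≡⟨ cong₂ slope (collapse-≥ S.drop a≤j) (collapse-≥ S.drop (ℕP.m≤n⇒m≤1+n a≤j)) ⟩
        slope (Y (2 + j)) (Y (3 + j))   ≡⟨ flip (2 + j) (s≤s (s≤s sj<m')) ⟩
        rev (slope (X (2 + j)) (X (3 + j)))  ≡⟨ cong rev (X.induces (2 + j) (s≤s (s≤s sj<m'))) ⟩
        rev (dirAt R (2 + j))           ≡⟨ contractDir-≥ R a a≤j ⟨
        contractDir R (suc a) j         ≡⟨ dirAt-contract R (suc a) sj<m' ⟨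
        dirAt R' j                      ∎
        where a≤j = ℕP.≮⇒≥ j≮a

    rooted : Rooted m' R' (Φ X)
    rooted = record
      { period2 = ≈-trans (diffuse-cong diffuse-Φ) diffuse-collapse
      ; moving  = λ fixed → no-double-step dd (X a) (begin
          (X a ℤ.+ ⟦ d ⟧) ℤ.+ ⟦ d ⟧   ≡⟨ S.jump ⟨
          Y a                          ≡⟨ collapse-≤ ℕP.≤-refl ⟨
          collapse a Y X a             ≡⟨ diffuse-Φ a a<m' ⟨
          diffuse m' (Φ X) a           ≡⟨ fixed a a<m' ⟩
          Φ X a                        ≡⟨ collapse-≤ ℕP.≤-refl ⟩
          X a                          ∎)
      ; root    = trans (at-prefix (λ _ → collapse-≤) a<m' a<n z≤n) X.root
      ; induces = induces
      }

    inverse : Ψ (Φ X) ≈⟨ n ⟩ X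
    inverse i i<n = go i (around a i) i<n
      where
      C = Φ X
      go : ∀ i → Around a i → i < n → Ψ C i ≡ X i
      go i (below i<a) _ = trans (expand-≤ (ℕP.<⇒≤ i<a)) (collapse-≤ (ℕP.<⇒≤ i<a))
      go .a at₀ _ = trans (expand-≤ ℕP.≤-refl) (collapse-≤ ℕP.≤-refl)
      go .(suc a) at₁ _ = trans expand-1 (trans (cong (ℤ._+ ⟦ d ⟧) (collapse-≤ ℕP.≤-refl)) (sym S.rise₁))
      go .(2 + a) at₂ _ = trans expand-2 (trans (cong (λ x → (x ℤ.+ ⟦ d ⟧) ℤ.+ ⟦ d ⟧) (collapse-≤ ℕP.≤-refl))
                                                (sym (trans S.rise₂ (cong (ℤ._+ ⟦ d ⟧) S.rise₁))))
      go .(2 + k) (above {k} a<k) (s≤s (s≤s k<m')) =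
        trans (expand-> a<k) (trans (diffuse-Φ k k<m') (collapse-> a<k))

  module Backward {X′ : ℕ → ℤ} (rX′ : Rooted m' R' X′) where

    private
      module X′ = Rooted rX′
      Y′ = diffuse m' X′
      E = Ψ X′
      flip = Period2.flip X′.period2

      edge : ∀ j → suc j < m' → slope (X′ j) (X′ (suc j)) ≡ contractDir R (suc a) j
      edge j sj<m' = trans (X′.induces j sj<m') (dirAt-contract R (suc a) sj<m')

      sb<m' : suc b < m'
      sb<m' = subst (_< m') a≡1+b a<m'

      b<a : b < a
      b<a = subst (b <_) (sym a≡1+b) (ℕP.n<1+n b)

      b→ : slope (X′ b) (X′ (suc b)) ≡ rev d
      b→ = trans (edge b sb<m') (trans (contractDir-< R a b<a) before)

      a→ : slope (X′ a) (X′ (suc a)) ≡ d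
      a→ = trans (edge a sa<m') (trans (contractDir-≥ R a ℕP.≤-refl) (trans (cong rev after) (rev-involutive d)))

      ←a : cmpDir (just (X′ a)) (leftOf m' X′ a) ≡ d
      ←a = leftOf-pull a≡1+b a<m' (subst (λ i → slope (X′ b) (X′ i) ≡ rev d) (sym a≡1+b) b→)

      Ya→ : slope (Y′ a) (Y′ (suc a)) ≡ rev d
      Ya→ = trans (flip a sa<m') (cong rev a→)

      ←Ya : cmpDir (just (Y′ a)) (leftOf m' Y′ a) ≡ rev d
      ←Ya = leftOf-pull a≡1+b a<m'
              (subst (λ i → slope (Y′ b) (Y′ i) ≡ rev (rev d)) (sym a≡1+b) (trans (flip b sb<m') (cong rev b→)))

      Ya : Y′ a ≡ (X′ a ℤ.+ ⟦ d ⟧) ℤ.+ ⟦ d ⟧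
      Ya = diffuse-pulled {m'} {X′} sa<m' ←a a→

    diffuse-Ψ : diffuse n E ≈⟨ n ⟩ expand a (rev d) Y′ X′
    diffuse-Ψ = expand-diffuse dd (λ _ _ → refl) (≈-sym X′.period2) sa<m' ←a a→ Ya→

    private
      diffuse-expand : diffuse n (expand a (rev d) Y′ X′) ≈⟨ n ⟩ E
      diffuse-expand = subst (λ e → diffuse n (expand a (rev d) Y′ X′) ≈⟨ n ⟩ expand a e X′ Y′) (rev-involutive d)
        (expand-diffuse (rev-directed dd) (≈-sym X′.period2) (λ _ _ → refl) sa<m' ←Ya Ya→
                        (trans a→ (sym (rev-involutive d))))

      upper : ∀ k → a ≤ k → 3 + k < n → slope (E (2 + k)) (E (3 + k)) ≡ dirAt R (2 + k)
      upper k a≤k (s≤s (s≤s sk<m')) = begin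
        slope (E (2 + k)) (E (3 + k))           ≡⟨ cong₂ slope (expand-≥ Ya a≤k) (expand-≥ Ya (ℕP.m≤n⇒m≤1+n a≤k)) ⟩
        slope (Y′ k) (Y′ (suc k))               ≡⟨ flip k sk<m' ⟩
        rev (slope (X′ k) (X′ (suc k)))         ≡⟨ cong rev (edge k sk<m') ⟩
        rev (contractDir R (suc a) k)           ≡⟨ cong rev (contractDir-≥ R a a≤k) ⟩
        rev (rev (dirAt R (2 + k)))             ≡⟨ rev-involutive _ ⟩
        dirAt R (2 + k)                         ∎

      induces : ∀ j → Around a j → suc j < n → slope (E j) (E (suc j)) ≡ dirAt R j
      induces j (below j<a) _ = begin
        slope (E j) (E (suc j))                 ≡⟨ cong₂ slope (expand-≤ (ℕP.<⇒≤ j<a)) (expand-≤ j<a) ⟩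
        slope (X′ j) (X′ (suc j))               ≡⟨ edge j (ℕP.≤-<-trans j<a a<m') ⟩
        contractDir R (suc a) j                 ≡⟨ contractDir-< R a j<a ⟩
        dirAt R j                               ∎
      induces .a at₀ _ = begin
        slope (E a) (E (suc a))                 ≡⟨ cong₂ slope (expand-≤ ℕP.≤-refl) expand-1 ⟩
        slope (X′ a) (X′ a ℤ.+ ⟦ d ⟧)           ≡⟨ slope-step dd (X′ a) ⟩
        d                                       ≡⟨ step₀ ⟨
        dirAt R a                               ∎
      induces .(suc a) at₁ _ = begin
        slope (E (suc a)) (E (2 + a))           ≡⟨ cong₂ slope expand-1 expand-2 ⟩
        slope (X′ a ℤ.+ ⟦ d ⟧) ((X′ a ℤ.+ ⟦ d ⟧) ℤ.+ ⟦ d ⟧)  ≡⟨ slope-step dd (X′ a ℤ.+ ⟦ d ⟧) ⟩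
        d                                       ≡⟨ step₁ ⟨
        dirAt R (suc a)                         ∎
      induces .(2 + a) at₂ s[2+a]<n = upper a ℕP.≤-refl s[2+a]<n
      induces .(2 + k) (above {k} a<k) s[2+k]<n = upper k (ℕP.<⇒≤ a<k) s[2+k]<n

    rooted : Rooted n R E
    rooted = record
      { period2 = ≈-trans (diffuse-cong diffuse-Ψ) diffuse-expand
      ; moving  = λ fixed → no-double-step dd (X′ a) (begin
          (X′ a ℤ.+ ⟦ d ⟧) ℤ.+ ⟦ d ⟧   ≡⟨ Ya ⟨
          Y′ a                          ≡⟨ expand-≤ ℕP.≤-refl ⟨
          expand a (rev d) Y′ X′ a      ≡⟨ diffuse-Ψ a a<n ⟨
          diffuse n E a                 ≡⟨ fixed a a<n ⟩
          E a                           ≡⟨ expand-≤ ℕP.≤-refl ⟩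
          X′ a                          ∎)
      ; root    = trans (at-prefix (λ _ → expand-≤) a<n a<m' z≤n) X′.root
      ; induces = λ j → induces j (around a j)
      }

    inverse : Φ E ≈⟨ m' ⟩ X′
    inverse i i<m' with i ≤? a
    ... | yes i≤a = trans (collapse-≤ i≤a) (expand-≤ i≤a)
    ... | no i≰a = trans (collapse-> a<i) (trans (diffuse-Ψ (2 + i) (s≤s (s≤s i<m'))) (expand-> a<i))
      where a<i = ℕP.≰⇒> i≰a

  contractC : Config n → Config m'
  contractC D = tabulate (Φ (get D) ∘ toℕ)

  expandC : Config m' → Config n
  expandC D′ = tabulate (Ψ (get D′) ∘ toℕ)

  contractC-rooted : ∀ {D} → P2Rooted n R D → P2Rooted m' R' (contractC D)
  contractC-rooted pD = Rooted⇒P2Rooted (Rooted-cong (≈-sym (get-tabulate _)) (Forward.rooted (P2Rooted⇒Rooted pD)))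

  expandC-rooted : ∀ {D′} → P2Rooted m' R' D′ → P2Rooted n R (expandC D′)
  expandC-rooted pD′ = Rooted⇒P2Rooted (Rooted-cong (≈-sym (get-tabulate _)) (Backward.rooted (P2Rooted⇒Rooted pD′)))

  expand∘contract : ∀ {D} → P2Rooted n R D → expandC (contractC D) ≡ D
  expand∘contract pD = get-injective (≈-trans (get-tabulate _)
    (≈-trans (expand-cong a<m' get-C≈ (diffuse-cong get-C≈)) (Forward.inverse (P2Rooted⇒Rooted pD))))
    where get-C≈ = get-tabulate _

  contract∘expand : ∀ {D′} → P2Rooted m' R' D′ → contractC (expandC D′) ≡ D′
  contract∘expand pD′ = get-injective (≈-trans (get-tabulate _)
    (≈-trans (collapse-cong get-E≈ (diffuse-cong get-E≈)) (Backward.inverse (P2Rooted⇒Rooted pD′))))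
    where get-E≈ = get-tabulate _

  same-count : ∀ k → (HasCount (P2Rooted n R) k → HasCount (P2Rooted m' R') k)
                   × (HasCount (P2Rooted m' R') k → HasCount (P2Rooted n R) k)
  same-count k =
    HasCount-transfer contractC expandC contractC-rooted expandC-rooted expand∘contract contract∘expand ,
    HasCount-transfer expandC contractC expandC-rooted contractC-rooted contract∘expand expand∘contract

agreeing-edges : ∀ {d e} → Agree d e → ∃ λ c → Directed c × d ≡ c × e ≡ c
agreeing-edges (inj₁ (d≡right , e≡right)) = right , right , d≡right , e≡right
agreeing-edges (inj₂ (d≡left , e≡left)) = left , left , d≡left , e≡left

corollary5 : (n : ℕ) → 4 ≤ n → (R : Orientation n) → IsP2Orientation n R →
    (k : ℕ) → 1 ≤ k → k + 2 ≤ n → Agree (dirAt R (k ∸ 1)) (dirAt R k) →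
    (m : ℕ) →
    (HasCount (P2Rooted n R) m → HasCount (P2Rooted (n ∸ 2) (contract n R k)) m)
    × (HasCount (P2Rooted (n ∸ 2) (contract n R k)) m → HasCount (P2Rooted n R) m)
corollary5 1 (s≤s ()) _ _ _ _ _ _ _
corollary5 (suc (suc m')) _ R isR (suc a) _ k+2≤n agree m with agreeing-edges agree
... | d , dd , a→ , sa→ = Contraction.same-count dd R (oriented-staircase dd isR 2+a<n a→ sa→) m
  where
  2+a<n : 2 + a < 2 + m'
  2+a<n = subst (_≤ 2 + m') (cong suc (ℕP.+-comm a 2)) k+2≤n
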